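{- In the \textsc{Normal Domination Game}, for every integer $n\geq 1$, the nimber of the position $P_n'$ and the nimber of the position $P_n''$ are both equal to $n \bmod 4$.
   Context: A vertex dominates itself and its neighbors. In the \textsc{Normal Domination Game} on a graph, two players alternately select playable vertices, where a vertex is playable if it dominates at least one vertex not dominated by previously selected vertices; the game ends when no vertex is playable, and the last player to move wins. $P_n'$ denotes the position of this game on the path $P_{n+2}$ (vertices $v_0,\dots,v_{n+1}$ in order) in which the first vertex $v_0$ is the only vertex already selected. $P_n''$ denotes the position on the path $P_{n+4}$ (vertices $v_0,\dots,v_{n+3}$ in order) in which the first and last vertices $v_0$ and $v_{n+3}$ are the only vertices already selected. (In both, exactly $n$ vertices remain to be dominated.) The nimber (Sprague–Grundy value) of a position is the minimum excludant (least non-negative integer not in the set) of the nimbers of positions reachable in one move; a position with no moves has nimber $0$. -}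

module Defs where

open import Data.Nat using (ℕ; zero; suc; _+_; _≡ᵇ_)
open import Data.Bool using (Bool; true; false; _∧_; _∨_; not; if_then_else_)
open import Data.Fin using (Fin; toℕ)
open import Data.List using (List; []; _∷_; map; filter; length)
open import Data.Bool.ListAction using (any)
open import Data.List using () renaming (allFin to allVertices)
open import Relation.Nullary.Decidable using (does)
open import Data.Fin using (_≟_)
open import Relation.Unary using (Decidable)

record Graph : Set where
  field
    size : ℕ
    adj  : Fin size → Fin size → Bool
open Graph public

Selection : Graph → Set
Selection G = Fin (size G) → Bool

dominates : (G : Graph) → Fin (size G) → Fin (size G) → Bool
dominates G v u = does (v ≟ u) ∨ adj G v u

dominatedBy : (G : Graph) → Selection G → Fin (size G) → Bool
dominatedBy G S u = any (λ s → S s ∧ dominates G s u) (allVertices (size G))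

playable : (G : Graph) → Selection G → Fin (size G) → Bool
playable G S v = any (λ u → dominates G v u ∧ not (dominatedBy G S u)) (allVertices (size G))

select : (G : Graph) → Selection G → Fin (size G) → Selection G
select G S v u = does (v ≟ u) ∨ S u

elemᵇ : ℕ → List ℕ → Bool
elemᵇ k [] = false
elemᵇ k (x ∷ xs) = (k ≡ᵇ x) ∨ elemᵇ k xs

mexFrom : ℕ → ℕ → List ℕ → ℕ
mexFrom k zero xs = k
mexFrom k (suc f) xs = if elemᵇ k xs then mexFrom (suc k) f xs else k

mex : List ℕ → ℕ
mex xs = mexFrom 0 (suc (length xs)) xs

playableMoves : (G : Graph) → Selection G → List (Fin (size G))
playableMoves G S = filter (λ v → Data.Bool._≟_ (playable G S v) true) (allVertices (size G))
  where import Data.Bool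

grundyFuel : ℕ → (G : Graph) → Selection G → ℕ
grundyFuel zero G S = 0
grundyFuel (suc f) G S = mex (map (λ v → grundyFuel f G (select G S v)) (playableMoves G S))

-- Every move dominates
-- at least one new vertex, so any play has at most  size G  moves; fuel
-- size G is therefore enough for the exact Sprague–Grundy value.
nimber : (G : Graph) → Selection G → ℕ
nimber G S = grundyFuel (size G) G S

path : ℕ → Graph
path m = record
  { size = m
  ; adj  = λ i j → (toℕ i ≡ᵇ suc (toℕ j)) ∨ (toℕ j ≡ᵇ suc (toℕ i)) }

P′-sel : (n : ℕ) → Selection (path (n + 2))
P′-sel n i = toℕ i ≡ᵇ 0

P″-sel : (n : ℕ) → Selection (path (n + 4))
P″-sel n i = (toℕ i ≡ᵇ 0) ∨ (toℕ i ≡ᵇ (n + 3))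

{-# OPTIONS --safe #-}
-- Record a position on a path by its profile: which vertices are dominated.  When v₀ is
-- dominated and no dominated vertex lies between two undominated ones, the undominated
-- vertices form independent runs, and a move either shortens one run by 1, 2 or 3 vertices
-- or splits a run of length a + 3 + b into runs of lengths a and b.  The nimber of such a
-- position is the nim-sum of the run lengths mod 4.  No move preserves this value: shortening
-- by 1 to 3 changes a length mod 4, and splitting changes the parity of the total length,
-- which is the low bit of the nim-sum.  Conversely, as in Bouton's analysis of Nim, every
-- smaller value is reached by shortening a run whose value carries the leading bit of the
-- difference.  P′ₙ and P″ₙ consist of a single run, of length n.
module Submission where

open import Defs
open import Data.Nat using (ℕ; _≤_; _+_; _%_)
open import Data.Product using (_×_)
open import Relation.Binary.PropositionalEquality using (_≡_)

open import Algebra.Bundles using (CommutativeMonoid)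
open import Algebra.Properties.CommutativeSemigroup using (interchange)
open import Data.Bool using (Bool; true; false; not; _∧_; _∨_; _xor_)
open import Data.Bool.Properties
  using (∨-identityʳ; ∨-zeroʳ; ∨-comm; ∨-commutativeMonoid; ∧-distribʳ-∨; ∧-conicalˡ; ∧-conicalʳ; T-≡;
         xor-assoc; xor-comm; xor-identityʳ; xor-same; not-involutive; not-¬; not-distribˡ-xor)
  renaming (_≟_ to _≟ᵇ_)
open import Data.Bool.ListAction using (or; any)
open import Data.Empty using (⊥; ⊥-elim)
open import Data.Fin using (Fin; zero; suc; toℕ; fromℕ<; _≟_)
open import Data.Fin.Properties using (toℕ-injective; toℕ<n; toℕ-fromℕ<; injective⇒≤)
open import Data.List using (List; []; _∷_; _++_; map; tabulate; filterᵇ; length; allFin; lookup; take; replicate; head)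
open import Data.List.Properties using (map-cong; map-tabulate; tabulate-cong; length-filter; length-tabulate; ++-identityʳ)
open import Data.List.Membership.Propositional using (_∈_; _∉_)
open import Data.List.Membership.Propositional.Properties using (∈-map⁺; ∈-map⁻; ∈-filter⁺; ∈-filter⁻; ∈-allFin)
open import Data.List.Relation.Unary.Any as Any using (Any; here; there; index)
open import Data.List.Relation.Unary.Any.Properties using (lookup-index)
open import Data.Maybe using (just)
open import Data.Nat using (zero; suc; _*_; _∸_; _/_; _<_; _≡ᵇ_; z≤n; s≤s; z<s; s<s)
open import Data.Nat.Properties
  using (≤-refl; ≤-trans; ≤-pred; <-trans; <⇒≤; <⇒≢; <⇒≱; n≮0; ≡ᵇ⇒≡; ≡⇒≡ᵇ; +-assoc; +-comm; +-suc; +-identityʳ;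
         +-monoʳ-<; m≤n+m; m∸n≤m; m∸n+n≡m; m<n⇒0<n∸m; m≤n⇒m<n∨m≡n; m≤n⇒m≤1+n; m<n⇒m<1+n)
open import Data.Nat.DivMod using (m%n<n; m≡m%n+[m/n]*n; [m+kn]%n≡m%n; m<n⇒m%n≡m)
open import Data.Product using (_,_; proj₁; proj₂; ∃; ∃₂)
open import Data.Sum using (_⊎_; inj₁; inj₂)
open import Data.Unit using (⊤; tt)
open import Function using (_∘_; Injective; Equivalence)
open import Relation.Binary.PropositionalEquality using (_≢_; refl; sym; trans; cong; cong₂; subst; module ≡-Reasoning)
open import Relation.Nullary using (¬_; does)
open import Relation.Nullary.Decidable using (T?)

-- Nimbers from labellings satisfying the mex conditions

elemᵇ-∈ : ∀ {k} xs → elemᵇ k xs ≡ true → k ∈ xs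
elemᵇ-∈ {k} (x ∷ xs) h with k ≡ᵇ x in k≡ᵇx
... | true  = here (≡ᵇ⇒≡ k x (Equivalence.from T-≡ k≡ᵇx))
... | false = there (elemᵇ-∈ xs h)

∈-elemᵇ : ∀ {k xs} → k ∈ xs → elemᵇ k xs ≡ true
∈-elemᵇ {k} {_ ∷ xs} (here refl) = cong (_∨ elemᵇ k xs) (Equivalence.to T-≡ (≡⇒≡ᵇ k k refl))
∈-elemᵇ {k} {x ∷ _} (there k∈xs) = trans (cong ((k ≡ᵇ x) ∨_) (∈-elemᵇ k∈xs)) (∨-zeroʳ (k ≡ᵇ x))

∉-elemᵇ : ∀ {k} xs → k ∉ xs → elemᵇ k xs ≡ false
∉-elemᵇ {k} xs k∉xs with elemᵇ k xs in h
... | true  = ⊥-elim (k∉xs (elemᵇ-∈ xs h))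
... | false = refl

pigeonhole : ∀ {v xs} → (∀ w → w < v → w ∈ xs) → v ≤ length xs
pigeonhole {v} {xs} below = injective⇒≤ {f = position} position-injective
  where
  open ≡-Reasoning
  position : Fin v → Fin (length xs)
  position i = index (below (toℕ i) (toℕ<n i))
  position-injective : Injective _≡_ _≡_ position
  position-injective {i} {j} eq = toℕ-injective (begin
    toℕ i                   ≡⟨ lookup-index (below (toℕ i) (toℕ<n i)) ⟩
    lookup xs (position i)  ≡⟨ cong (lookup xs) eq ⟩
    lookup xs (position j)  ≡⟨ lookup-index (below (toℕ j) (toℕ<n j)) ⟨
    toℕ j                   ∎)

mexFrom-≡ : ∀ f {k v xs} → k ≤ v → v < k + f → (∀ w → k ≤ w → w < v → w ∈ xs) → v ∉ xs →
            mexFrom k f xs ≡ v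
mexFrom-≡ zero {k} {v} k≤v v<k+0 _ _ = ⊥-elim (<⇒≱ (subst (v <_) (+-identityʳ k) v<k+0) k≤v)
mexFrom-≡ (suc f) {k} {v} {xs} k≤v v<k+f below v∉xs with m≤n⇒m<n∨m≡n k≤v
... | inj₂ refl rewrite ∉-elemᵇ xs v∉xs = refl
... | inj₁ k<v rewrite ∈-elemᵇ (below k ≤-refl k<v) =
  mexFrom-≡ f k<v (subst (v <_) (+-suc k f) v<k+f) (λ w k<w → below w (<⇒≤ k<w)) v∉xs

mex-unique : ∀ {v xs} → v ∉ xs → (∀ w → w < v → w ∈ xs) → mex xs ≡ v
mex-unique {v} {xs} v∉xs below =
  mexFrom-≡ (suc (length xs)) z≤n (s≤s (pigeonhole below)) (λ w _ → below w) v∉xs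

or-tabulate-false : ∀ n → or (tabulate {n = n} (λ _ → false)) ≡ false
or-tabulate-false zero    = refl
or-tabulate-false (suc n) = or-tabulate-false n

or-tabulate-∨ : ∀ {n} (f g : Fin n → Bool) →
                or (tabulate (λ i → f i ∨ g i)) ≡ or (tabulate f) ∨ or (tabulate g)
or-tabulate-∨ {zero}  f g = refl
or-tabulate-∨ {suc n} f g =
  trans (cong ((f zero ∨ g zero) ∨_) (or-tabulate-∨ (f ∘ suc) (g ∘ suc)))
        (interchange (CommutativeMonoid.commutativeSemigroup ∨-commutativeMonoid) (f zero) (g zero) _ _)

or-tabulate-≟ : ∀ {n} (v : Fin n) (f : Fin n → Bool) → or (tabulate (λ s → does (v ≟ s) ∧ f s)) ≡ f v
or-tabulate-≟ {suc n} zero    f = trans (cong (f zero ∨_) (or-tabulate-false n)) (∨-identityʳ (f zero))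
or-tabulate-≟         (suc v) f = or-tabulate-≟ v (f ∘ suc)

any-allFin : ∀ n (p : Fin n → Bool) → any p (allFin n) ≡ or (tabulate p)
any-allFin n p = cong or (map-tabulate (λ i → i) p)

dominatedBy-select : ∀ G S v u → dominatedBy G (select G S v) u ≡ dominates G v u ∨ dominatedBy G S u
dominatedBy-select G S v u = begin
  any (λ s → (does (v ≟ s) ∨ S s) ∧ dom s) (allFin n)
    ≡⟨ any-allFin n _ ⟩
  or (tabulate (λ s → (does (v ≟ s) ∨ S s) ∧ dom s))
    ≡⟨ cong or (tabulate-cong (λ s → ∧-distribʳ-∨ (dom s) (does (v ≟ s)) (S s))) ⟩
  or (tabulate (λ s → (does (v ≟ s) ∧ dom s) ∨ (S s ∧ dom s)))
    ≡⟨ or-tabulate-∨ (λ s → does (v ≟ s) ∧ dom s) (λ s → S s ∧ dom s) ⟩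
  or (tabulate (λ s → does (v ≟ s) ∧ dom s)) ∨ or (tabulate (λ s → S s ∧ dom s))
    ≡⟨ cong₂ _∨_ (or-tabulate-≟ v dom) (sym (any-allFin n _)) ⟩
  dominates G v u ∨ dominatedBy G S u
    ∎
  where
  open ≡-Reasoning
  n = size G
  dom : Fin n → Bool
  dom s = dominates G s u

undominated : (G : Graph) → Selection G → ℕ
undominated G S = length (filterᵇ (not ∘ dominatedBy G S) (allFin (size G)))

undominated≤size : ∀ G S → undominated G S ≤ size G
undominated≤size G S =
  subst (undominated G S ≤_) (length-tabulate (λ i → i))
        (length-filter (T? ∘ not ∘ dominatedBy G S) (allFin (size G)))

module _ {A : Set} {p q : A → Bool} (p⇒q : ∀ x → p x ≡ true → q x ≡ true) where

  length-filterᵇ-mono : ∀ xs → length (filterᵇ p xs) ≤ length (filterᵇ q xs)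
  length-filterᵇ-mono []       = z≤n
  length-filterᵇ-mono (x ∷ xs) with p x in px | q x in qx
  ... | true  | true  = s≤s (length-filterᵇ-mono xs)
  ... | true  | false with () ← trans (sym (p⇒q x px)) qx
  ... | false | true  = m≤n⇒m≤1+n (length-filterᵇ-mono xs)
  ... | false | false = length-filterᵇ-mono xs

  length-filterᵇ-< : ∀ {xs} → Any (λ x → p x ≡ false × q x ≡ true) xs →
                     length (filterᵇ p xs) < length (filterᵇ q xs)
  length-filterᵇ-< {x ∷ xs} (here (px , qx)) rewrite px | qx = s≤s (length-filterᵇ-mono xs)
  length-filterᵇ-< {x ∷ xs} (there found) with p x in px | q x in qx
  ... | true  | true  = s≤s (length-filterᵇ-< found)
  ... | true  | false with () ← trans (sym (p⇒q x px)) qx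
  ... | false | true  = m<n⇒m<1+n (length-filterᵇ-< found)
  ... | false | false = length-filterᵇ-< found

any⇒Any : ∀ {A : Set} (f : A → Bool) xs → any f xs ≡ true → Any (λ x → f x ≡ true) xs
any⇒Any f (x ∷ xs) h with f x in fx
... | true  = here fx
... | false = there (any⇒Any f xs h)

undominated-select : ∀ G S v → playable G S v ≡ true → undominated G (select G S v) < undominated G S
undominated-select G S v pl =
  length-filterᵇ-< stays-dominated (Any.map newly (any⇒Any _ (allFin (size G)) pl))
  where
  not-∨ʳ : ∀ a {b} → not (a ∨ b) ≡ true → not b ≡ true
  not-∨ʳ false h = h
  stays-dominated : ∀ u → not (dominatedBy G (select G S v) u) ≡ true → not (dominatedBy G S u) ≡ true
  stays-dominated u h = not-∨ʳ (dominates G v u) (subst (λ b → not b ≡ true) (dominatedBy-select G S v u) h)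
  newly : ∀ {u} → dominates G v u ∧ not (dominatedBy G S u) ≡ true →
          not (dominatedBy G (select G S v) u) ≡ false × not (dominatedBy G S u) ≡ true
  newly {u} h =
    cong not (trans (dominatedBy-select G S v u) (cong (_∨ dominatedBy G S u) (∧-conicalˡ _ _ h))) ,
    ∧-conicalʳ _ _ h

record GrundyLabelling (G : Graph) : Set₁ where
  field
    Valid        : Selection G → Set
    label        : Selection G → ℕ
    valid-select : ∀ {S v} → Valid S → playable G S v ≡ true → Valid (select G S v)
    label-select : ∀ {S v} → Valid S → playable G S v ≡ true → label (select G S v) ≢ label S
    label-reach  : ∀ {S w} → Valid S → w < label S →
                   ∃ λ v → playable G S v ≡ true × label (select G S v) ≡ w

module _ {G : Graph} (L : GrundyLabelling G) where
  open GrundyLabelling L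

  grundyFuel≡label : ∀ f {S} → Valid S → undominated G S ≤ f → grundyFuel f G S ≡ label S
  grundyFuel≡label zero {S} valid rank≤0 with label S in label≡
  ... | zero  = refl
  ... | suc _ with v , pl , _ ← label-reach valid (subst (0 <_) (sym label≡) (s≤s z≤n)) =
    ⊥-elim (n≮0 (≤-trans (undominated-select G S v pl) rank≤0))
  grundyFuel≡label (suc f) {S} valid rank≤ = mex-unique label∉ below
    where
    moves = playableMoves G S
    next : Fin (size G) → ℕ
    next v = grundyFuel f G (select G S v)
    playable⇒∈ : ∀ {v} → playable G S v ≡ true → v ∈ moves
    playable⇒∈ pl = ∈-filter⁺ (λ v → playable G S v ≟ᵇ true) (∈-allFin _) pl
    next≡label : ∀ {v} → playable G S v ≡ true → next v ≡ label (select G S v)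
    next≡label pl = grundyFuel≡label f (valid-select valid pl)
                      (≤-pred (≤-trans (undominated-select G S _ pl) rank≤))
    label∉ : label S ∉ map next moves
    label∉ ∈next with v , v∈ , label≡ ← ∈-map⁻ next ∈next =
      label-select valid pl (sym (trans label≡ (next≡label pl)))
      where pl = proj₂ (∈-filter⁻ (λ v → playable G S v ≟ᵇ true) {xs = allFin (size G)} v∈)
    below : ∀ w → w < label S → w ∈ map next moves
    below w w< with v , pl , label≡w ← label-reach valid w< =
      subst (_∈ map next moves) (trans (next≡label pl) label≡w) (∈-map⁺ next (playable⇒∈ pl))

  nimber≡label : ∀ {S} → Valid S → nimber G S ≡ label S
  nimber≡label {S} valid = grundyFuel≡label (size G) valid (undominated≤size G S)

-- Nim values below 4

-- A nimber below 4 in binary, (high bit , low bit); nim-addition is bitwise xor.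
Nim : Set
Nim = Bool × Bool

infixl 6 _⊕_

_⊕_ : Nim → Nim → Nim
x ⊕ y = (proj₁ x xor proj₁ y , proj₂ x xor proj₂ y)

⟦_⟧ : Nim → ℕ
⟦ false , false ⟧ = 0
⟦ false , true  ⟧ = 1
⟦ true  , false ⟧ = 2
⟦ true  , true  ⟧ = 3

sucᴺ : Nim → Nim
sucᴺ x = (proj₁ x xor proj₂ x , not (proj₂ x))

mod4 : ℕ → Nim
mod4 zero    = (false , false)
mod4 (suc k) = sucᴺ (mod4 k)

⊕-assoc : ∀ x y z → (x ⊕ y) ⊕ z ≡ x ⊕ (y ⊕ z)
⊕-assoc x y z = cong₂ _,_ (xor-assoc (proj₁ x) _ _) (xor-assoc (proj₂ x) _ _)

⊕-comm : ∀ x y → x ⊕ y ≡ y ⊕ x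
⊕-comm x y = cong₂ _,_ (xor-comm (proj₁ x) _) (xor-comm (proj₂ x) _)

⊕-identityʳ : ∀ x → x ⊕ mod4 0 ≡ x
⊕-identityʳ x = cong₂ _,_ (xor-identityʳ (proj₁ x)) (xor-identityʳ (proj₂ x))

⊕-self : ∀ x → x ⊕ x ≡ mod4 0
⊕-self x = cong₂ _,_ (xor-same (proj₁ x)) (xor-same (proj₂ x))

⊕-involutiveˡ : ∀ x y → x ⊕ (x ⊕ y) ≡ y
⊕-involutiveˡ x y = begin
  x ⊕ (x ⊕ y)  ≡⟨ ⊕-assoc x x y ⟨
  (x ⊕ x) ⊕ y  ≡⟨ cong (_⊕ y) (⊕-self x) ⟩
  y            ∎
  where open ≡-Reasoning

⊕-cancelˡ : ∀ x {y z} → x ⊕ y ≡ x ⊕ z → y ≡ z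
⊕-cancelˡ x {y} {z} eq = begin
  y            ≡⟨ ⊕-involutiveˡ x y ⟨
  x ⊕ (x ⊕ y)  ≡⟨ cong (x ⊕_) eq ⟩
  x ⊕ (x ⊕ z)  ≡⟨ ⊕-involutiveˡ x z ⟩
  z            ∎
  where open ≡-Reasoning

⊕-cancelʳ : ∀ x {y z} → y ⊕ x ≡ z ⊕ x → y ≡ z
⊕-cancelʳ x {y} {z} eq = ⊕-cancelˡ x (trans (⊕-comm x y) (trans eq (⊕-comm z x)))

mod4-⟦⟧ : ∀ x → mod4 ⟦ x ⟧ ≡ x
mod4-⟦⟧ (false , false) = refl
mod4-⟦⟧ (false , true)  = refl
mod4-⟦⟧ (true  , false) = refl
mod4-⟦⟧ (true  , true)  = refl

⟦⟧-injective : ∀ {x y} → ⟦ x ⟧ ≡ ⟦ y ⟧ → x ≡ y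
⟦⟧-injective {x} {y} eq = trans (sym (mod4-⟦⟧ x)) (trans (cong mod4 eq) (mod4-⟦⟧ y))

⟦⟧<4 : ∀ x → ⟦ x ⟧ < 4
⟦⟧<4 (false , false) = s≤s z≤n
⟦⟧<4 (false , true)  = s≤s (s≤s z≤n)
⟦⟧<4 (true  , false) = s≤s (s≤s (s≤s z≤n))
⟦⟧<4 (true  , true)  = s≤s (s≤s (s≤s (s≤s z≤n)))

sucᴺ-period : ∀ x → sucᴺ (sucᴺ (sucᴺ (sucᴺ x))) ≡ x
sucᴺ-period (false , false) = refl
sucᴺ-period (false , true)  = refl
sucᴺ-period (true  , false) = refl
sucᴺ-period (true  , true)  = refl

⟦mod4⟧ : ∀ k → ⟦ mod4 k ⟧ ≡ k % 4
⟦mod4⟧ 0 = refl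
⟦mod4⟧ 1 = refl
⟦mod4⟧ 2 = refl
⟦mod4⟧ 3 = refl
⟦mod4⟧ (suc (suc (suc (suc k)))) = begin
  ⟦ mod4 (4 + k) ⟧  ≡⟨ cong ⟦_⟧ (sucᴺ-period (mod4 k)) ⟩
  ⟦ mod4 k ⟧        ≡⟨ ⟦mod4⟧ k ⟩
  k % 4             ≡⟨ [m+kn]%n≡m%n k 1 4 ⟨
  (k + 4) % 4       ≡⟨ cong (_% 4) (+-comm k 4) ⟩
  (4 + k) % 4       ∎
  where open ≡-Reasoning

⟦mod4⟧-< : ∀ {w} → w < 4 → ⟦ mod4 w ⟧ ≡ w
⟦mod4⟧-< {w} w<4 = trans (⟦mod4⟧ w) (m<n⇒m%n≡m w<4)

mod4-periodic : ∀ a q → mod4 (a + q * 4) ≡ mod4 a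
mod4-periodic a q = ⟦⟧-injective (begin
  ⟦ mod4 (a + q * 4) ⟧  ≡⟨ ⟦mod4⟧ (a + q * 4) ⟩
  (a + q * 4) % 4       ≡⟨ [m+kn]%n≡m%n a q 4 ⟩
  a % 4                 ≡⟨ ⟦mod4⟧ a ⟨
  ⟦ mod4 a ⟧            ∎)
  where open ≡-Reasoning

-- k′ is the largest number below k that is congruent to ⟦ x ⟧ modulo 4.
mod4-descend : ∀ k x → ⟦ x ⟧ < ⟦ mod4 k ⟧ →
               ∃₂ λ j k′ → k ≡ j + k′ × 0 < j × j ≤ 3 × mod4 k′ ≡ x
mod4-descend k x x<mod4k =
  j , ⟦ x ⟧ + q * 4 , k≡j+k′ , m<n⇒0<n∸m x<r , ≤-trans (m∸n≤m r ⟦ x ⟧) r≤3 ,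
  trans (mod4-periodic ⟦ x ⟧ q) (mod4-⟦⟧ x)
  where
  open ≡-Reasoning
  r = k % 4
  q = k / 4
  j = r ∸ ⟦ x ⟧
  x<r : ⟦ x ⟧ < r
  x<r = subst (⟦ x ⟧ <_) (⟦mod4⟧ k) x<mod4k
  r≤3 : r ≤ 3
  r≤3 = ≤-pred (m%n<n k 4)
  k≡j+k′ : k ≡ j + (⟦ x ⟧ + q * 4)
  k≡j+k′ = begin
    k                      ≡⟨ m≡m%n+[m/n]*n k 4 ⟩
    r + q * 4              ≡⟨ cong (_+ q * 4) (m∸n+n≡m (<⇒≤ x<r)) ⟨
    (j + ⟦ x ⟧) + q * 4    ≡⟨ +-assoc j ⟦ x ⟧ (q * 4) ⟩
    j + (⟦ x ⟧ + q * 4)    ∎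

sucᴺ-no-short-cycle : ∀ x → sucᴺ x ≢ x × sucᴺ (sucᴺ x) ≢ x × sucᴺ (sucᴺ (sucᴺ x)) ≢ x
sucᴺ-no-short-cycle (false , false) = (λ ()) , (λ ()) , (λ ())
sucᴺ-no-short-cycle (false , true)  = (λ ()) , (λ ()) , (λ ())
sucᴺ-no-short-cycle (true  , false) = (λ ()) , (λ ()) , (λ ())
sucᴺ-no-short-cycle (true  , true)  = (λ ()) , (λ ()) , (λ ())

mod4-shrink : ∀ {j} m → 0 < j → j ≤ 3 → mod4 (j + m) ≢ mod4 m
mod4-shrink {1} m _ _ = proj₁ (sucᴺ-no-short-cycle (mod4 m))
mod4-shrink {2} m _ _ = proj₁ (proj₂ (sucᴺ-no-short-cycle (mod4 m)))
mod4-shrink {3} m _ _ = proj₂ (proj₂ (sucᴺ-no-short-cycle (mod4 m)))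
mod4-shrink {suc (suc (suc (suc _)))} m _ (s≤s (s≤s (s≤s ())))

data Digit : Set where
  high low : Digit

_at_ : Nim → Digit → Bool
x at high = proj₁ x
x at low  = proj₂ x

⊕-at-false : ∀ x y i → x at i ≡ false → (x ⊕ y) at i ≡ y at i
⊕-at-false x y high x₁≡false = cong (_xor proj₁ y) x₁≡false
⊕-at-false x y low  x₂≡false = cong (_xor proj₂ y) x₂≡false

low-mod4-+ : ∀ m n → mod4 (m + n) at low ≡ (mod4 m at low) xor (mod4 n at low)
low-mod4-+ zero    n = refl
low-mod4-+ (suc m) n = trans (cong not (low-mod4-+ m n)) (not-distribˡ-xor (mod4 m at low) _)

-- The highest set bit (junk for the zero nimber).
leading : Nim → Digit
leading (true  , _) = high
leading (false , _) = low

leading-of-larger : ∀ x w → ⟦ w ⟧ < ⟦ x ⟧ → x at leading (x ⊕ w) ≡ true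
leading-of-larger (false , true)  (false , false) _ = refl
leading-of-larger (true  , _)     (false , _)     _ = refl
leading-of-larger (true  , true)  (true  , false) _ = refl
leading-of-larger (false , false) _ ()
leading-of-larger (false , true)  (false , true)  (s≤s ())
leading-of-larger (false , true)  (true  , false) (s≤s ())
leading-of-larger (false , true)  (true  , true)  (s≤s ())
leading-of-larger (true  , false) (true  , false) (s≤s (s≤s ()))
leading-of-larger (true  , false) (true  , true)  (s≤s (s≤s ()))
leading-of-larger (true  , true)  (true  , true)  (s≤s (s≤s (s≤s ())))

clear-leading : ∀ t r → t ≢ mod4 0 → r at leading t ≡ true → ⟦ r ⊕ t ⟧ < ⟦ r ⟧
clear-leading (false , false) _               t≢0 _  = ⊥-elim (t≢0 refl)
clear-leading (true  , false) (true  , false) _   _  = z<s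
clear-leading (true  , false) (true  , true)  _   _  = s<s z<s
clear-leading (true  , true)  (true  , false) _   _  = s<s z<s
clear-leading (true  , true)  (true  , true)  _   _  = z<s
clear-leading (false , true)  (false , true)  _   _  = z<s
clear-leading (false , true)  (true  , true)  _   _  = s<s (s<s z<s)
clear-leading (true  , _)     (false , _)     _   ()
clear-leading (false , true)  (_     , false) _   ()

bouton : ∀ x w r → ⟦ w ⟧ < ⟦ x ⟧ → r at leading (x ⊕ w) ≡ true → ⟦ r ⊕ (x ⊕ w) ⟧ < ⟦ r ⟧
bouton x w r w<x = clear-leading (x ⊕ w) r x⊕w≢0
  where
  x⊕w≢0 : x ⊕ w ≢ mod4 0
  x⊕w≢0 eq = <⇒≢ w<x (cong ⟦_⟧ (⊕-cancelˡ x {w} {x} (trans eq (sym (⊕-self x)))))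

⊕-retarget : ∀ a r b t → a ⊕ ((r ⊕ t) ⊕ b) ≡ (a ⊕ (r ⊕ b)) ⊕ t
⊕-retarget a r b t = begin
  a ⊕ ((r ⊕ t) ⊕ b)  ≡⟨ cong (a ⊕_) (⊕-assoc r t b) ⟩
  a ⊕ (r ⊕ (t ⊕ b))  ≡⟨ cong (λ y → a ⊕ (r ⊕ y)) (⊕-comm t b) ⟩
  a ⊕ (r ⊕ (b ⊕ t))  ≡⟨ cong (a ⊕_) (⊕-assoc r b t) ⟨
  a ⊕ ((r ⊕ b) ⊕ t)  ≡⟨ ⊕-assoc a (r ⊕ b) t ⟨
  (a ⊕ (r ⊕ b)) ⊕ t  ∎
  where open ≡-Reasoning

-- Domination profiles

markFirst : ℕ → List Bool → List Bool
markFirst zero    d       = d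
markFirst (suc n) []      = []
markFirst (suc n) (_ ∷ d) = true ∷ markFirst n d

-- Entry i of a profile says whether vᵢ is dominated; playing vₖ dominates entries
-- k - 1, k and k + 1.
dominate : ℕ → List Bool → List Bool
dominate zero          d       = markFirst 2 d
dominate (suc zero)    d       = markFirst 3 d
dominate (suc (suc k)) []      = []
dominate (suc (suc k)) (x ∷ d) = x ∷ dominate (suc k) d

dominatesNew : ℕ → List Bool → Bool
dominatesNew zero          d       = any not (take 2 d)
dominatesNew (suc zero)    d       = any not (take 3 d)
dominatesNew (suc (suc k)) []      = false
dominatesNew (suc (suc k)) (_ ∷ d) = dominatesNew (suc k) d

-- The nim-sum of the lengths mod 4 of the maximal runs of undominated entries, for a
-- profile that is preceded by k undominated entries.
runsValue : ℕ → List Bool → Nim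
runsValue k []          = mod4 k
runsValue k (true ∷ d)  = mod4 k ⊕ runsValue 0 d
runsValue k (false ∷ d) = runsValue (suc k) d

value : List Bool → Nim
value = runsValue 0

-- Playing the dominated middle vertex would shorten two runs at once.
Bridge : List Bool → Set
Bridge (false ∷ true ∷ false ∷ _) = ⊤
Bridge _                          = ⊥

Bridgeless : List Bool → Set
Bridgeless []      = ⊤
Bridgeless (x ∷ d) = ¬ Bridge (x ∷ d) × Bridgeless d

-- With v₀ dominated, every run is preceded by a dominated vertex.
Admissible : List Bool → Set
Admissible d = head d ≡ just true × Bridgeless d

Bridgeless-markFirst : ∀ n d → Bridgeless d → Bridgeless (markFirst n d)
Bridgeless-markFirst zero    d       bl        = bl
Bridgeless-markFirst (suc n) []      _         = tt
Bridgeless-markFirst (suc n) (_ ∷ d) (_ , bl)  = (λ ()) , Bridgeless-markFirst n d bl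

-- A move marks its whole window, which has at least two entries unless it ends the list.
¬Bridge-dominate : ∀ k d → ¬ Bridge (false ∷ d) → ¬ Bridge (false ∷ dominate (suc k) d)
¬Bridge-dominate zero          []                _  ()
¬Bridge-dominate zero          (_ ∷ [])          _  ()
¬Bridge-dominate zero          (_ ∷ _ ∷ _)       _  ()
¬Bridge-dominate (suc k)       []                _  ()
¬Bridge-dominate (suc k)       (false ∷ _)       _  ()
¬Bridge-dominate (suc zero)    (true ∷ [])       _  ()
¬Bridge-dominate (suc zero)    (true ∷ _ ∷ _)    _  ()
¬Bridge-dominate (suc (suc k)) (true ∷ [])       _  ()
¬Bridge-dominate (suc (suc k)) (true ∷ true ∷ _) _  ()
¬Bridge-dominate (suc (suc k)) (true ∷ false ∷ _) nb = nb

Bridgeless-dominate : ∀ k d → Bridgeless d → Bridgeless (dominate k d)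
Bridgeless-dominate zero          d            bl        = Bridgeless-markFirst 2 d bl
Bridgeless-dominate (suc zero)    d            bl        = Bridgeless-markFirst 3 d bl
Bridgeless-dominate (suc (suc k)) []           _         = tt
Bridgeless-dominate (suc (suc k)) (true ∷ d)   (_ , bl)  = (λ ()) , Bridgeless-dominate (suc k) d bl
Bridgeless-dominate (suc (suc k)) (false ∷ d)  (nb , bl) =
  ¬Bridge-dominate k d nb , Bridgeless-dominate (suc k) d bl

Admissible-dominate : ∀ k d → Admissible d → Admissible (dominate k d)
Admissible-dominate k d (hd , bl) = head-dominate k d hd , Bridgeless-dominate k d bl
  where
  head-dominate : ∀ k d → head d ≡ just true → head (dominate k d) ≡ just true
  head-dominate zero          (_ ∷ _) _  = refl
  head-dominate (suc zero)    (_ ∷ _) _  = refl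
  head-dominate (suc (suc k)) (_ ∷ _) hd = hd

runsValue-leading : ∀ d → ∃₂ λ s e → ∀ c → runsValue c d ≡ mod4 (c + s) ⊕ e
runsValue-leading [] =
  0 , mod4 0 , λ c → sym (trans (⊕-identityʳ (mod4 (c + 0))) (cong mod4 (+-identityʳ c)))
runsValue-leading (true ∷ d) =
  0 , value d , λ c → cong (λ k → mod4 k ⊕ value d) (sym (+-identityʳ c))
runsValue-leading (false ∷ d) with s , e , split ← runsValue-leading d =
  suc s , e , λ c → trans (split (suc c)) (cong (λ k → mod4 k ⊕ e) (sym (+-suc c s)))

shrink-≢ : ∀ a c d {j} → 0 < j → j ≤ 3 → a ⊕ runsValue c d ≢ a ⊕ runsValue (j + c) d
shrink-≢ a c d {j} 0<j j≤3 eq with s , e , split ← runsValue-leading d =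
  mod4-shrink (c + s) 0<j j≤3 (sym (⊕-cancelʳ e (begin
    mod4 (c + s) ⊕ e        ≡⟨ split c ⟨
    runsValue c d           ≡⟨ ⊕-cancelˡ a eq ⟩
    runsValue (j + c) d     ≡⟨ split (j + c) ⟩
    mod4 (j + c + s) ⊕ e    ≡⟨ cong (λ k → mod4 k ⊕ e) (+-assoc j c s) ⟩
    mod4 (j + (c + s)) ⊕ e  ∎)))
  where open ≡-Reasoning

-- The low bit of the value is the parity of the total length of the runs.
split-≢ : ∀ c d → mod4 c ⊕ runsValue 0 d ≢ runsValue (3 + c) d
split-≢ c d eq with s , e , split ← runsValue-leading d = not-¬ refl (begin
  b xor l                                   ≡⟨ cong (_xor l) (low-mod4-+ c s) ⟩
  (mod4 c at low xor mod4 s at low) xor l   ≡⟨ xor-assoc (mod4 c at low) _ _ ⟩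
  (mod4 c ⊕ (mod4 s ⊕ e)) at low            ≡⟨ cong (λ x → (mod4 c ⊕ x) at low) (split 0) ⟨
  (mod4 c ⊕ runsValue 0 d) at low           ≡⟨ cong (_at low) eq ⟩
  runsValue (3 + c) d at low                ≡⟨ cong (_at low) (split (3 + c)) ⟩
  not (not (not b)) xor l                   ≡⟨ cong (_xor l) (not-involutive (not b)) ⟩
  not b xor l                               ≡⟨ not-distribˡ-xor b l ⟨
  not (b xor l)                             ∎)
  where
  open ≡-Reasoning
  b = mod4 (c + s) at low
  l = e at low

value-dominate₀-≢ : ∀ d → dominatesNew 0 d ≡ true → value (dominate 0 d) ≢ value d
value-dominate₀-≢ (false ∷ [])        _ = shrink-≢ (mod4 0) 0 [] {1} (s≤s z≤n) (s≤s z≤n)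
value-dominate₀-≢ (false ∷ false ∷ d) _ = shrink-≢ (mod4 0) 0 d {2} (s≤s z≤n) (s≤s (s≤s z≤n))
value-dominate₀-≢ (false ∷ true ∷ d)  _ = shrink-≢ (mod4 0) 0 (true ∷ d) {1} (s≤s z≤n) (s≤s z≤n)
value-dominate₀-≢ (true ∷ false ∷ d)  _ = shrink-≢ (mod4 0) 0 d {1} (s≤s z≤n) (s≤s z≤n)
value-dominate₀-≢ []                  ()
value-dominate₀-≢ (true ∷ [])         ()
value-dominate₀-≢ (true ∷ true ∷ _)   ()

runsValue-dominate-≢ : ∀ c k d → Bridgeless d → dominatesNew (suc k) d ≡ true →
                       runsValue c (dominate (suc k) d) ≢ runsValue c d
runsValue-dominate-≢ c (suc k) (true ∷ d)  (_ , bl) new eq =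
  runsValue-dominate-≢ 0 k d bl new (⊕-cancelˡ (mod4 c) eq)
runsValue-dominate-≢ c (suc k) (false ∷ d) (_ , bl) new eq =
  runsValue-dominate-≢ (suc c) k d bl new eq
runsValue-dominate-≢ c zero (true ∷ d) _ new eq =
  value-dominate₀-≢ d new (⊕-cancelˡ (mod4 c) eq)
runsValue-dominate-≢ c zero (false ∷ false ∷ false ∷ d) _ _ =
  split-≢ c d
runsValue-dominate-≢ c zero (false ∷ false ∷ true ∷ d)  _ _ =
  shrink-≢ (mod4 0) c (true ∷ d) {2} (s≤s z≤n) (s≤s (s≤s z≤n))
runsValue-dominate-≢ c zero (false ∷ true ∷ true ∷ d)   _ _ =
  shrink-≢ (mod4 0) c (true ∷ d) {1} (s≤s z≤n) (s≤s z≤n)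
runsValue-dominate-≢ c zero (false ∷ true ∷ false ∷ d)  (nb , _) _ =
  ⊥-elim (nb tt)
runsValue-dominate-≢ c zero (false ∷ false ∷ []) _ _ eq =
  shrink-≢ (mod4 0) c [] {2} (s≤s z≤n) (s≤s (s≤s z≤n)) (trans (sym (⊕-identityʳ (mod4 c))) eq)
runsValue-dominate-≢ c zero (false ∷ true ∷ [])  _ _ =
  shrink-≢ (mod4 0) c (true ∷ []) {1} (s≤s z≤n) (s≤s z≤n)
runsValue-dominate-≢ c zero (false ∷ []) _ _ eq =
  shrink-≢ (mod4 0) c [] {1} (s≤s z≤n) (s≤s z≤n) (trans (sym (⊕-identityʳ (mod4 c))) eq)
runsValue-dominate-≢ c zero    [] _ ()
runsValue-dominate-≢ c (suc k) [] _ ()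

value-dominate-≢ : ∀ k d → Bridgeless d → dominatesNew k d ≡ true → value (dominate k d) ≢ value d
value-dominate-≢ zero    d _ = value-dominate₀-≢ d
value-dominate-≢ (suc k) d   = runsValue-dominate-≢ 0 k d

data RunEnd : List Bool → Set where
  end       : RunEnd []
  dominated : ∀ d → RunEnd (true ∷ d)

data Run : List Bool → ℕ → Set where
  run : ∀ pre k {post} → RunEnd post → Run (pre ++ true ∷ replicate k false ++ post) k

runsValue-falses : ∀ c k d → runsValue c (replicate k false ++ d) ≡ runsValue (k + c) d
runsValue-falses c zero    d = refl
runsValue-falses c (suc k) d = trans (runsValue-falses (suc c) k d) (cong (λ m → runsValue m d) (+-suc k c))

runsValue-runEnd : ∀ c {post} → RunEnd post → runsValue c post ≡ mod4 c ⊕ value post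
runsValue-runEnd c end           = sym (⊕-identityʳ (mod4 c))
runsValue-runEnd c (dominated d) = refl

value-run : ∀ k {post} → RunEnd post → value (replicate k false ++ post) ≡ mod4 k ⊕ value post
value-run k {post} e = begin
  value (replicate k false ++ post)  ≡⟨ runsValue-falses 0 k post ⟩
  runsValue (k + 0) post             ≡⟨ runsValue-runEnd (k + 0) e ⟩
  mod4 (k + 0) ⊕ value post          ≡⟨ cong (λ m → mod4 m ⊕ value post) (+-identityʳ k) ⟩
  mod4 k ⊕ value post                ∎
  where open ≡-Reasoning

runsValue-++-true : ∀ c pre d → runsValue c (pre ++ true ∷ d) ≡ runsValue c pre ⊕ value d
runsValue-++-true c []          d = refl
runsValue-++-true c (true ∷ p)  d =
  trans (cong (mod4 c ⊕_) (runsValue-++-true 0 p d)) (sym (⊕-assoc (mod4 c) (value p) (value d)))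
runsValue-++-true c (false ∷ p) d = runsValue-++-true (suc c) p d

value-trues : ∀ j d → value (replicate j true ++ d) ≡ value d
value-trues zero    d = refl
value-trues (suc j) d = value-trues j d

value-++-run : ∀ pre k {post} → RunEnd post →
               value (pre ++ true ∷ replicate k false ++ post) ≡ value pre ⊕ (mod4 k ⊕ value post)
value-++-run pre k {post} e =
  trans (runsValue-++-true 0 pre (replicate k false ++ post)) (cong (value pre ⊕_) (value-run k e))

findRun : ∀ i c d → runsValue c d at i ≡ true →
          (∃₂ λ k post → d ≡ replicate k false ++ post × RunEnd post × mod4 (c + k) at i ≡ true)
          ⊎ (∃ λ k → Run d k × mod4 k at i ≡ true)
findRun i c [] bit = inj₁ (0 , [] , refl , end , subst (λ m → mod4 m at i ≡ true) (sym (+-identityʳ c)) bit)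
findRun i c (true ∷ d) bit with mod4 c at i in bitc
... | true  =
  inj₁ (0 , true ∷ d , refl , dominated d , subst (λ m → mod4 m at i ≡ true) (sym (+-identityʳ c)) bitc)
... | false with findRun i 0 d (trans (sym (⊕-at-false (mod4 c) (value d) i bitc)) bit)
...   | inj₁ (k , post , refl , e , bitk) = inj₂ (k , run [] k e , bitk)
...   | inj₂ (k , run pre .k e , bitk)    = inj₂ (k , run (true ∷ pre) k e , bitk)
findRun i c (false ∷ d) bit with findRun i (suc c) d bit
... | inj₁ (k , post , refl , e , bitk) =
  inj₁ (suc k , post , refl , e , subst (λ m → mod4 m at i ≡ true) (sym (+-suc c k)) bitk)
... | inj₂ (k , run pre .k e , bitk) = inj₂ (k , run (false ∷ pre) k e , bitk)

findRun₀ : ∀ i d → head d ≡ just true → value d at i ≡ true → ∃ λ k → Run d k × mod4 k at i ≡ true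
findRun₀ i d hd bit with findRun i 0 d bit
... | inj₂ found = found
findRun₀ high d hd bit | inj₁ (zero , _ , _ , _ , ())
findRun₀ low  d hd bit | inj₁ (zero , _ , _ , _ , ())
findRun₀ i .(false ∷ _) () bit | inj₁ (suc k , _ , refl , _ , _)

Move : ℕ → List Bool → List Bool → Set
Move v d d′ = v < length d × dominatesNew v d ≡ true × dominate v d ≡ d′

Move-∷ : ∀ x {v d d′} → Move (suc v) d d′ → Move (suc (suc v)) (x ∷ d) (x ∷ d′)
Move-∷ x (v<len , new , moved) = s≤s v<len , new , cong (x ∷_) moved

Move-++ : ∀ pre {i d d′} → Move (suc i) d d′ → Move (suc (length pre + i)) (pre ++ d) (pre ++ d′)
Move-++ []        mv = mv
Move-++ (x ∷ pre) mv = Move-∷ x (Move-++ pre mv)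

shrink₁ : ∀ pre X → Bridgeless (pre ++ true ∷ false ∷ X) →
          Move (length pre) (pre ++ true ∷ false ∷ X) (pre ++ true ∷ true ∷ X)
shrink₁ []            X _        = s≤s z≤n , refl , refl
shrink₁ (true ∷ [])   X _        = s≤s (s≤s z≤n) , refl , refl
shrink₁ (false ∷ [])  X (nb , _) = ⊥-elim (nb tt)
shrink₁ (x ∷ y ∷ pre) X (_ , bl) = Move-∷ x (shrink₁ (y ∷ pre) X bl)

shrinkRun : ∀ pre {j} k′ post → 0 < j → j ≤ 3 →
            Bridgeless (pre ++ true ∷ replicate (j + k′) false ++ post) →
            ∃ λ v → Move v (pre ++ true ∷ replicate (j + k′) false ++ post)
                           (pre ++ true ∷ replicate j true ++ replicate k′ false ++ post)
shrinkRun pre {1} k′ post _ _ bl = length pre , shrink₁ pre _ bl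
shrinkRun pre {2} k′ post _ _ _  = _ , Move-++ pre {0} (s≤s (s≤s z≤n) , refl , refl)
shrinkRun pre {3} k′ post _ _ _  = _ , Move-++ pre {1} (s≤s (s≤s (s≤s z≤n)) , refl , refl)
shrinkRun pre {suc (suc (suc (suc _)))} _ _ _ (s≤s (s≤s (s≤s ()))) _

-- Bouton's move: with t = value d ⊕ w, shorten a run whose value r has the leading bit of t
-- set, so that its value becomes r ⊕ t < r.
value-reach : ∀ d w → Admissible d → ⟦ w ⟧ < ⟦ value d ⟧ → ∃₂ λ v d′ → Move v d d′ × value d′ ≡ w
value-reach d w (hd , bl) w<x
  with findRun₀ (leading (value d ⊕ w)) d hd (leading-of-larger (value d) w w<x)
... | k , run pre .k {post} e , bitk
  with mod4-descend k (mod4 k ⊕ (value d ⊕ w)) (bouton (value d) w (mod4 k) w<x bitk)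
...   | j , k′ , refl , 0<j , j≤3 , mod4k′
  with shrinkRun pre k′ post 0<j j≤3 bl
...     | v , mv = v , _ , mv , (begin
  value (pre ++ true ∷ replicate j true ++ replicate k′ false ++ post)
    ≡⟨ runsValue-++-true 0 pre _ ⟩
  value pre ⊕ value (replicate j true ++ replicate k′ false ++ post)
    ≡⟨ cong (value pre ⊕_) (trans (value-trues j _) (value-run k′ e)) ⟩
  value pre ⊕ (mod4 k′ ⊕ value post)
    ≡⟨ cong (λ r → value pre ⊕ (r ⊕ value post)) mod4k′ ⟩
  value pre ⊕ ((mod4 (j + k′) ⊕ t) ⊕ value post)
    ≡⟨ ⊕-retarget (value pre) (mod4 (j + k′)) (value post) t ⟩
  (value pre ⊕ (mod4 (j + k′) ⊕ value post)) ⊕ t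
    ≡⟨ cong (_⊕ t) (value-++-run pre (j + k′) e) ⟨
  x ⊕ (x ⊕ w)
    ≡⟨ ⊕-involutiveˡ x w ⟩
  w ∎)
  where
  open ≡-Reasoning
  x = value (pre ++ true ∷ replicate (j + k′) false ++ post)
  t = x ⊕ w

Bridgeless-falses : ∀ n d → Bridgeless d → ¬ Bridge (false ∷ d) → Bridgeless (replicate n false ++ d)
Bridgeless-falses zero          d bl _  = bl
Bridgeless-falses (suc zero)    d bl nb = nb , bl
Bridgeless-falses (suc (suc n)) d bl nb = (λ ()) , Bridgeless-falses (suc n) d bl nb

dominate-end : ∀ n → dominate (suc n) (replicate (2 + n) false) ≡ replicate n false ++ true ∷ true ∷ []
dominate-end zero    = refl
dominate-end (suc n) = cong (false ∷_) (dominate-end n)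

-- Positions on paths

profile : ∀ m → Selection (path m) → List Bool
profile m S = tabulate (dominatedBy (path m) S)

tabulate-dominate : ∀ {m} (v : Fin m) (D : Fin m → Bool) →
                    tabulate (λ u → dominates (path m) v u ∨ D u) ≡ dominate (toℕ v) (tabulate D)
tabulate-dominate {suc zero}          zero          D = refl
tabulate-dominate {suc (suc m)}       zero          D = refl
tabulate-dominate {suc (suc zero)}    (suc zero)    D = refl
tabulate-dominate {suc (suc (suc m))} (suc zero)    D = refl
tabulate-dominate {suc (suc m)}       (suc (suc v)) D = cong (D zero ∷_) (tabulate-dominate (suc v) (D ∘ suc))

tabulate-dominatesNew : ∀ {m} (v : Fin m) (D : Fin m → Bool) →
                        or (tabulate (λ u → dominates (path m) v u ∧ not (D u))) ≡ dominatesNew (toℕ v) (tabulate D)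
tabulate-dominatesNew {suc zero}          zero          D = refl
tabulate-dominatesNew {suc (suc m)}       zero          D =
  cong (λ b → not (D zero) ∨ (not (D (suc zero)) ∨ b)) (or-tabulate-false m)
tabulate-dominatesNew {suc (suc zero)}    (suc zero)    D = refl
tabulate-dominatesNew {suc (suc (suc m))} (suc zero)    D =
  cong (λ b → not (D zero) ∨ (not (D (suc zero)) ∨ (not (D (suc (suc zero))) ∨ b))) (or-tabulate-false m)
tabulate-dominatesNew {suc (suc m)}       (suc (suc v)) D = tabulate-dominatesNew (suc v) (D ∘ suc)

profile-select : ∀ m S v → profile m (select (path m) S v) ≡ dominate (toℕ v) (profile m S)
profile-select m S v =
  trans (tabulate-cong (dominatedBy-select (path m) S v)) (tabulate-dominate v (dominatedBy (path m) S))

playable-path : ∀ m S v → playable (path m) S v ≡ dominatesNew (toℕ v) (profile m S)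
playable-path m S v = trans (any-allFin m _) (tabulate-dominatesNew v (dominatedBy (path m) S))

path-reach : ∀ m {S w} → Admissible (profile m S) → w < ⟦ value (profile m S) ⟧ →
             ∃ λ v → playable (path m) S v ≡ true × ⟦ value (profile m (select (path m) S v)) ⟧ ≡ w
path-reach m {S} {w} adm w<
  with ⟦mod4w⟧ ← ⟦mod4⟧-< (<-trans w< (⟦⟧<4 (value (profile m S))))
  with k , d′ , (k<len , new , moved) , value≡
         ← value-reach (profile m S) (mod4 w) adm (subst (_< _) (sym ⟦mod4w⟧) w<) =
  v , pl , label≡
  where
  open ≡-Reasoning
  d = profile m S
  k<m : k < m
  k<m = subst (k <_) (length-tabulate (dominatedBy (path m) S)) k<len
  v = fromℕ< k<m
  toℕv : toℕ v ≡ k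
  toℕv = toℕ-fromℕ< k<m
  pl = trans (playable-path m S v) (trans (cong (λ i → dominatesNew i d) toℕv) new)
  label≡ = begin
    ⟦ value (profile m (select (path m) S v)) ⟧  ≡⟨ cong (⟦_⟧ ∘ value) (profile-select m S v) ⟩
    ⟦ value (dominate (toℕ v) d) ⟧               ≡⟨ cong (λ i → ⟦ value (dominate i d) ⟧) toℕv ⟩
    ⟦ value (dominate k d) ⟧                     ≡⟨ cong (⟦_⟧ ∘ value) moved ⟩
    ⟦ value d′ ⟧                                 ≡⟨ cong ⟦_⟧ value≡ ⟩
    ⟦ mod4 w ⟧                                   ≡⟨ ⟦mod4w⟧ ⟩
    w                                            ∎

pathLabelling : ∀ m → GrundyLabelling (path m)
pathLabelling m = record
  { Valid        = λ S → Admissible (profile m S)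
  ; label        = λ S → ⟦ value (profile m S) ⟧
  ; valid-select = λ {S} {v} adm _ →
      subst Admissible (sym (profile-select m S v)) (Admissible-dominate (toℕ v) (profile m S) adm)
  ; label-select = λ {S} {v} (_ , bl) pl eq →
      value-dominate-≢ (toℕ v) (profile m S) bl (trans (sym (playable-path m S v)) pl)
        (⟦⟧-injective (trans (cong (⟦_⟧ ∘ value) (sym (profile-select m S v))) eq))
  ; label-reach  = path-reach m
  }

nimber-path : ∀ {m S} → Admissible (profile m S) → nimber (path m) S ≡ ⟦ value (profile m S) ⟧
nimber-path {m} = nimber≡label (pathLabelling m)

profile-cong : ∀ m {S S′} → (∀ u → S u ≡ S′ u) → profile m S ≡ profile m S′
profile-cong m S≗S′ =
  tabulate-cong (λ u → cong or (map-cong (λ s → cong (_∧ dominates (path m) s u) (S≗S′ s)) (allFin m)))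

profile-∅ : ∀ m → profile m (λ _ → false) ≡ replicate m false
profile-∅ m = trans (tabulate-cong (λ u → trans (any-allFin m _) (or-tabulate-false m))) (tabulate-false m)
  where
  tabulate-false : ∀ n → tabulate {n = n} (λ _ → false) ≡ replicate n false
  tabulate-false zero    = refl
  tabulate-false (suc n) = cong (false ∷_) (tabulate-false n)

does-≟ : ∀ {m k} (v u : Fin m) → toℕ v ≡ k → does (v ≟ u) ≡ (toℕ u ≡ᵇ k)
does-≟ zero    zero    refl = refl
does-≟ zero    (suc u) refl = refl
does-≟ (suc v) zero    refl = refl
does-≟ (suc v) (suc u) refl = does-≟ v u refl

module _ (n : ℕ) where
  open ≡-Reasoning

  0<n+2 : 0 < n + 2
  0<n+2 = ≤-trans (s≤s z≤n) (m≤n+m 2 n)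

  v₀ : Fin (n + 2)
  v₀ = fromℕ< 0<n+2

  P′-as-select : ∀ u → P′-sel n u ≡ select (path (n + 2)) (λ _ → false) v₀ u
  P′-as-select u = sym (trans (∨-identityʳ _) (does-≟ v₀ u (toℕ-fromℕ< 0<n+2)))

  profile-P′ : profile (n + 2) (P′-sel n) ≡ true ∷ true ∷ replicate n false ++ []
  profile-P′ = begin
    profile (n + 2) (P′-sel n)
      ≡⟨ profile-cong (n + 2) P′-as-select ⟩
    profile (n + 2) (select (path (n + 2)) (λ _ → false) v₀)
      ≡⟨ profile-select (n + 2) _ v₀ ⟩
    dominate (toℕ v₀) (profile (n + 2) (λ _ → false))
      ≡⟨ cong₂ dominate (toℕ-fromℕ< 0<n+2) (profile-∅ (n + 2)) ⟩
    dominate 0 (replicate (n + 2) false)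
      ≡⟨ cong (λ k → dominate 0 (replicate k false)) (+-comm n 2) ⟩
    true ∷ true ∷ replicate n false
      ≡⟨ cong (λ d → true ∷ true ∷ d) (++-identityʳ _) ⟨
    true ∷ true ∷ replicate n false ++ []
      ∎

  0<n+4 : 0 < n + 4
  0<n+4 = ≤-trans (s≤s z≤n) (m≤n+m 4 n)

  n+3<n+4 : n + 3 < n + 4
  n+3<n+4 = +-monoʳ-< n ≤-refl

  w₀ wₑ : Fin (n + 4)
  w₀ = fromℕ< 0<n+4
  wₑ = fromℕ< n+3<n+4

  S₀ : Selection (path (n + 4))
  S₀ = select (path (n + 4)) (λ _ → false) w₀

  P″-as-select : ∀ u → P″-sel n u ≡ select (path (n + 4)) S₀ wₑ u
  P″-as-select u = begin
    (toℕ u ≡ᵇ 0) ∨ (toℕ u ≡ᵇ n + 3)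
      ≡⟨ ∨-comm (toℕ u ≡ᵇ 0) _ ⟩
    (toℕ u ≡ᵇ n + 3) ∨ (toℕ u ≡ᵇ 0)
      ≡⟨ cong₂ _∨_ (does-≟ wₑ u (toℕ-fromℕ< n+3<n+4)) (does-≟ w₀ u (toℕ-fromℕ< 0<n+4)) ⟨
    does (wₑ ≟ u) ∨ does (w₀ ≟ u)
      ≡⟨ cong (does (wₑ ≟ u) ∨_) (∨-identityʳ _) ⟨
    does (wₑ ≟ u) ∨ (does (w₀ ≟ u) ∨ false)
      ∎

  profile-P″ : profile (n + 4) (P″-sel n) ≡ true ∷ true ∷ replicate n false ++ true ∷ true ∷ []
  profile-P″ = begin
    profile (n + 4) (P″-sel n)
      ≡⟨ profile-cong (n + 4) P″-as-select ⟩
    profile (n + 4) (select (path (n + 4)) S₀ wₑ)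
      ≡⟨ profile-select (n + 4) S₀ wₑ ⟩
    dominate (toℕ wₑ) (profile (n + 4) S₀)
      ≡⟨ cong (dominate (toℕ wₑ)) (profile-select (n + 4) _ w₀) ⟩
    dominate (toℕ wₑ) (dominate (toℕ w₀) (profile (n + 4) (λ _ → false)))
      ≡⟨ cong₂ (λ i d → dominate i (dominate (toℕ w₀) d)) (toℕ-fromℕ< n+3<n+4) (profile-∅ (n + 4)) ⟩
    dominate (n + 3) (dominate (toℕ w₀) (replicate (n + 4) false))
      ≡⟨ cong₂ (λ i k → dominate i (dominate (toℕ w₀) (replicate k false))) (+-comm n 3) (+-comm n 4) ⟩
    dominate (3 + n) (dominate (toℕ w₀) (replicate (4 + n) false))
      ≡⟨ cong (λ i → dominate (3 + n) (dominate i (replicate (4 + n) false))) (toℕ-fromℕ< 0<n+4) ⟩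
    true ∷ true ∷ dominate (suc n) (replicate (2 + n) false)
      ≡⟨ cong (λ d → true ∷ true ∷ d) (dominate-end n) ⟩
    true ∷ true ∷ replicate n false ++ true ∷ true ∷ []
      ∎

nimber-run : ∀ {m S} n {post} → profile m S ≡ true ∷ true ∷ replicate n false ++ post →
             RunEnd post → value post ≡ mod4 0 → Bridgeless (false ∷ post) → nimber (path m) S ≡ n % 4
nimber-run {m} {S} n {post} prof e value≡0 (nb , bl) = begin
  nimber (path m) S                      ≡⟨ nimber-path (subst Admissible (sym prof) admissible) ⟩
  ⟦ value (profile m S) ⟧                ≡⟨ cong (⟦_⟧ ∘ value) prof ⟩
  ⟦ value (replicate n false ++ post) ⟧  ≡⟨ cong ⟦_⟧ (value-run n e) ⟩
  ⟦ mod4 n ⊕ value post ⟧                ≡⟨ cong (λ x → ⟦ mod4 n ⊕ x ⟧) value≡0 ⟩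
  ⟦ mod4 n ⊕ mod4 0 ⟧                    ≡⟨ cong ⟦_⟧ (⊕-identityʳ (mod4 n)) ⟩
  ⟦ mod4 n ⟧                             ≡⟨ ⟦mod4⟧ n ⟩
  n % 4                                  ∎
  where
  open ≡-Reasoning
  admissible : Admissible (true ∷ true ∷ replicate n false ++ post)
  admissible = refl , (λ ()) , (λ ()) , Bridgeless-falses n post bl nb

-- The formula also holds for n = 0.
lemma2 : (n : ℕ) → 1 ≤ n →
    (nimber (path (n + 2)) (P′-sel n) ≡ n % 4) × (nimber (path (n + 4)) (P″-sel n) ≡ n % 4)
lemma2 n _ =
  nimber-run n (profile-P′ n) end refl ((λ ()) , tt) ,
  nimber-run n (profile-P″ n) (dominated _) refl ((λ ()) , (λ ()) , (λ ()) , tt)
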